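{- Let $\mathcal{T} = (T,\tau)$ be a hierarchical tile assembly system. If $\alpha,\beta$ are $\mathcal{T}$-producible assemblies that are consistent and $\mathrm{dom}\,\alpha \cap \mathrm{dom}\,\beta \neq \emptyset$, then $\alpha \cup \beta$ is $\mathcal{T}$-producible. Furthermore, $\alpha \to \alpha \cup \beta$, i.e., there is an assembly tree of $\alpha\cup\beta$ in which $\alpha$ labels a node (so it is possible to assemble exactly $\alpha$, then to assemble the missing portions of $\beta$).
   Context: A tile type is a unit square with, on each of its four sides, a glue label and a nonnegative integer strength. An assembly is a partial function $\alpha:\mathbb{Z}^2 \dashrightarrow T$ with finite nonempty domain whose full grid graph is connected. Two tiles at adjacent positions interact if the glue labels on their abutting sides are equal and of positive strength; the binding graph has vertices $\mathrm{dom}\,\alpha$ and edges between interacting positions, weighted by glue strength; $\alpha$ is $\tau$-stable if every cut of its binding graph has weight at least $\tau$. A hierarchical tile assembly system is a pair $\mathcal{T}=(T,\tau)$ with $T$ a finite set of tile types and $\tau \in \mathbb{Z}^+$. An assembly $\gamma$ is $\mathcal{T}$-producible if either it is a single tile (of a type in $T$), or $\gamma = \alpha \cup \beta$ for producible assemblies $\alpha,\beta$ with disjoint domains and $\gamma$ is $\tau$-stable; write $\alpha + \beta \to_1 \gamma$ in that case. An assembly tree of a producible $\hat\alpha$ is a full binary tree whose nodes are labeled by producible assemblies, with $\hat\alpha$ at the root, single-tile assemblies at the $|\hat\alpha|$ leaves, and each internal node labeled $\gamma$ with children labeled $\alpha,\beta$ satisfying $\alpha+\beta\to_1\gamma$.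 Write $\alpha \to \gamma$ if $\alpha$ is a descendant node of $\gamma$ (or equals it) in some assembly tree. Assemblies $\alpha,\beta$ are consistent if $\alpha(p) = \beta(p)$ for all $p \in \mathrm{dom}\,\alpha \cap \mathrm{dom}\,\beta$; then $\alpha\cup\beta$ is the assembly with domain $\mathrm{dom}\,\alpha \cup \mathrm{dom}\,\beta$ agreeing with $\alpha$ on $\mathrm{dom}\,\alpha$ and with $\beta$ on $\mathrm{dom}\,\beta$. -}

module Defs where

open import Data.Nat as ℕ using (ℕ; _≤_)
open import Data.Integer as ℤ using (ℤ)
open import Data.Bool using (Bool; true; false; if_then_else_; not)
open import Data.Product using (_×_; _,_; proj₁; proj₂; Σ; ∃)
open import Data.Product.Properties using (≡-dec)
open import Data.List using (List; []; _∷_; map; filter; _++_; concatMap)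
open import Data.Nat.ListAction using (sum)
open import Data.List.Membership.Propositional using (_∈_; _∉_)
open import Data.List.Relation.Unary.Unique.Propositional using (Unique)
open import Data.Maybe using (Maybe; just; nothing)
open import Relation.Nullary using (¬_; does; ¬?)
open import Relation.Binary.PropositionalEquality using (_≡_; _≢_)
open import Relation.Binary.Definitions using (DecidableEquality)

-- A glue: a label (drawn from ℕ) together with a nonnegative strength.
Glue : Set
Glue = ℕ × ℕ

_≟g_ : DecidableEquality Glue
_≟g_ = ≡-dec ℕ._≟_ ℕ._≟_

strength : Glue → ℕ
strength = proj₂

record Tile : Set where
  constructor tile
  field
    north east south west : Glue
open Tile public

Pos : Set
Pos = ℤ × ℤ

_≟p_ : DecidableEquality Pos
_≟p_ = ≡-dec ℤ._≟_ ℤ._≟_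

data GridAdj : Pos → Pos → Set where
  east-nb  : ∀ x y → GridAdj (x , y) (x ℤ.+ ℤ.+ 1 , y)
  west-nb  : ∀ x y → GridAdj (x ℤ.+ ℤ.+ 1 , y) (x , y)
  north-nb : ∀ x y → GridAdj (x , y) (x , y ℤ.+ ℤ.+ 1)
  south-nb : ∀ x y → GridAdj (x , y ℤ.+ ℤ.+ 1) (x , y)

-- Assemblies: finite partial functions ℤ² ⇀ Tile, represented as a list
-- of (position, tile) pairs with pairwise distinct positions.

Assembly : Set
Assembly = List (Pos × Tile)

dom : Assembly → List Pos
dom = map proj₁

lookup : Assembly → Pos → Maybe Tile
lookup [] p = nothing
lookup ((q , t) ∷ α) p = if does (q ≟p p) then just t else lookup α p

_≐_ : Assembly → Assembly → Set
α ≐ β = ∀ p → lookup α p ≡ lookup β p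

data Path (α : Assembly) : Pos → Pos → Set where
  here : ∀ {p} → Path α p p
  step : ∀ {p q r} → GridAdj p q → q ∈ dom α → Path α q r → Path α p r

GridConnected : Assembly → Set
GridConnected α = ∀ p q → p ∈ dom α → q ∈ dom α → Path α p q

IsAssembly : Assembly → Set
IsAssembly α = (α ≢ []) × Unique (dom α) × GridConnected α

glueBond : Glue → Glue → ℕ
glueBond g h = if does (g ≟g h) then strength g else 0

bond : Pos × Tile → Pos × Tile → ℕ
bond ((x , y) , t) ((x' , y') , u) =
  if does ((x ℤ.+ ℤ.+ 1 , y) ≟p (x' , y')) then glueBond (east t) (west u) else
  if does ((x , y) ≟p (x' ℤ.+ ℤ.+ 1 , y')) then glueBond (west t) (east u) else
  if does ((x , y ℤ.+ ℤ.+ 1) ≟p (x' , y')) then glueBond (north t) (south u) else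
  if does ((x , y) ≟p (x' , y' ℤ.+ ℤ.+ 1)) then glueBond (south t) (north u) else 0

-- A cut of the binding graph is given by a 2-colouring c of the positions;
-- it is a genuine cut if both colour classes meet dom α.
NontrivialCut : Assembly → (Pos → Bool) → Set
NontrivialCut α c = (∃ λ p → p ∈ dom α × c p ≡ true) × (∃ λ p → p ∈ dom α × c p ≡ false)

cutWeight : Assembly → (Pos → Bool) → ℕ
cutWeight α c =
  sum (concatMap (λ e → map (λ e' →
        if c (proj₁ e) then (if c (proj₁ e') then 0 else bond e e') else 0) α) α)

Stable : ℕ → Assembly → Set
Stable τ α = ∀ c → NontrivialCut α c → τ ≤ cutWeight α c

_∪_ : Assembly → Assembly → Assembly
α ∪ β = α ++ filter (λ e → ¬? (proj₁ e ∈? dom α)) β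
  where open import Data.List.Membership.DecPropositional _≟p_ using (_∈?_)

DisjointDom : Assembly → Assembly → Set
DisjointDom α β = ∀ p → p ∈ dom α → p ∉ dom β

Consistent : Assembly → Assembly → Set
Consistent α β = ∀ p t u → lookup α p ≡ just t → lookup β p ≡ just u → t ≡ u

record HTAS : Set where
  field
    T : List Tile
    τ : ℕ
    τ-pos : 1 ≤ τ
open HTAS public

record Combines (𝒯 : HTAS) (α β γ : Assembly) : Set where
  field
    disjoint : DisjointDom α β
    union    : γ ≐ (α ∪ β)
    assembly : IsAssembly γ
    stable   : Stable (τ 𝒯) γ

data Producible (𝒯 : HTAS) : Assembly → Set where
  single  : ∀ p t → t ∈ T 𝒯 → Producible 𝒯 ((p , t) ∷ [])
  combine : ∀ {α β γ} → Producible 𝒯 α → Producible 𝒯 β →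
            Combines 𝒯 α β γ → Producible 𝒯 γ

data AssemblyTree (𝒯 : HTAS) : Assembly → Set where
  leaf : ∀ p t → t ∈ T 𝒯 → AssemblyTree 𝒯 ((p , t) ∷ [])
  node : ∀ {α β γ} → AssemblyTree 𝒯 α → AssemblyTree 𝒯 β →
         Combines 𝒯 α β γ → AssemblyTree 𝒯 γ

data OccursIn {𝒯 : HTAS} (α : Assembly) : ∀ {γ} → AssemblyTree 𝒯 γ → Set where
  at-root : ∀ {γ} {t : AssemblyTree 𝒯 γ} → α ≐ γ → OccursIn α t
  in-left : ∀ {α₁ β₁ γ} {l : AssemblyTree 𝒯 α₁} {r : AssemblyTree 𝒯 β₁}
              {c : Combines 𝒯 α₁ β₁ γ} → OccursIn α l → OccursIn α (node l r c)
  in-right : ∀ {α₁ β₁ γ} {l : AssemblyTree 𝒯 α₁} {r : AssemblyTree 𝒯 β₁}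
              {c : Combines 𝒯 α₁ β₁ γ} → OccursIn α r → OccursIn α (node l r c)

_⟶⟨_⟩_ : Assembly → HTAS → Assembly → Set
α ⟶⟨ 𝒯 ⟩ γ = Σ (AssemblyTree 𝒯 γ) (OccursIn α)

-- Induction on an assembly tree of β.  If β is a single tile, it already lies in α.
-- If β = β₁ + β₂, then α overlaps β₁ or β₂, say β₁: by induction α ∪ β₁ has a tree
-- containing α as a node.  Either α ∪ β₁ also overlaps β₂, and a second induction
-- adds β₂, or it is disjoint from β₂ and one final attachment α ∪ β₁ + β₂ → α ∪ β
-- finishes.  Every attachment is legal because the union of two overlapping,
-- consistent stable assemblies is stable: a cut of the union separates the common
-- tile from some tile of α or of β, so it cuts α or β, and both are contained in
-- α ∪ β, so their cut weights are at most that of the union.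
module Submission where

open import Defs
open import Data.Bool using (Bool; true; false; if_then_else_)
open import Data.Empty using (⊥; ⊥-elim)
open import Data.List using (List; []; _∷_; [_]; map; filter; _++_; concatMap)
open import Data.List.Properties using (map-++; ++-identityʳ; ++-conicalˡ; filter-none)
open import Data.List.Membership.Propositional using (_∈_; _∉_; find; lose)
open import Data.List.Membership.Propositional.Properties
  using (∈-map⁺; ∈-++⁺ˡ; ∈-++⁺ʳ; ∈-++⁻; ∈-filter⁺; ∈-filter⁻; ∈-∃++)
open import Data.List.Membership.DecPropositional _≟p_ using (_∈?_)
open import Data.List.Relation.Binary.Subset.Propositional using (_⊆_)
open import Data.List.Relation.Binary.Permutation.Propositional.Properties using (shift; map⁺)
open import Data.List.Relation.Unary.Any using (here; there; any?)
import Data.List.Relation.Unary.All as All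
open import Data.List.Relation.Unary.AllPairs using ([]; _∷_)
open import Data.List.Relation.Unary.Unique.Propositional using (Unique)
import Data.List.Relation.Unary.Unique.Propositional.Properties as Unique
open import Data.Maybe using (Maybe; just; nothing; _<∣>_)
open import Data.Maybe.Properties using (<∣>-assoc)
open import Data.Nat using (ℕ; _≤_; _+_; z≤n)
open import Data.Nat.ListAction using (sum)
open import Data.Nat.ListAction.Properties using (sum-++; sum-↭)
open import Data.Nat.Properties using (≤-trans; +-mono-≤; +-monoʳ-≤; module ≤-Reasoning)
open import Data.Product using (Σ; ∃; _×_; _,_; proj₁; proj₂)
open import Data.Sum as Sum using (_⊎_; inj₁; inj₂)
open import Function using (_∘_)
open import Level using (Level)
open import Relation.Nullary using (¬_; yes; no; ¬?; does)
open import Relation.Unary using (Pred; Decidable)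
open import Relation.Binary.PropositionalEquality
  using (_≡_; _≢_; refl; sym; trans; cong; subst; module ≡-Reasoning)

private
  variable
    ℓ : Level
    A : Set
    xs ys : List A
    α β γ δ : Assembly
    p q : Pos
    t u : Tile

lookup-++ : ∀ α β p → lookup (α ++ β) p ≡ lookup α p <∣> lookup β p
lookup-++ [] β p = refl
lookup-++ ((q , t) ∷ α) β p with q ≟p p
... | yes _ = refl
... | no _ = lookup-++ α β p

lookup-just⇒∈ : ∀ α → lookup α p ≡ just t → (p , t) ∈ α
lookup-just⇒∈ [] ()
lookup-just⇒∈ {p} ((q , u) ∷ α) eq with q ≟p p
lookup-just⇒∈ ((q , u) ∷ α) refl | yes refl = here refl
... | no _ = there (lookup-just⇒∈ α eq)

lookup-just⇒∈dom : ∀ α → lookup α p ≡ just t → p ∈ dom α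
lookup-just⇒∈dom α = ∈-map⁺ proj₁ ∘ lookup-just⇒∈ α

∈dom⇒lookup-just : ∀ α → p ∈ dom α → ∃ λ t → lookup α p ≡ just t
∈dom⇒lookup-just {p} ((q , u) ∷ α) p∈ with q ≟p p
... | yes _ = u , refl
∈dom⇒lookup-just ((q , u) ∷ α) (here p≡q) | no q≢p = ⊥-elim (q≢p (sym p≡q))
∈dom⇒lookup-just ((q , u) ∷ α) (there p∈) | no _ = ∈dom⇒lookup-just α p∈

∈⇒lookup-just : ∀ α → Unique (dom α) → (p , t) ∈ α → lookup α p ≡ just t
∈⇒lookup-just {p} ((q , u) ∷ α) (q∉α ∷ uα) p,t∈ with q ≟p p | p,t∈
... | yes _ | here refl = refl
... | yes refl | there p,t∈α = ⊥-elim (All.lookup q∉α (∈-map⁺ proj₁ p,t∈α) refl)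
... | no q≢p | here refl = ⊥-elim (q≢p refl)
... | no _ | there p,t∈α = ∈⇒lookup-just α uα p,t∈α

lookup-filter : ∀ {P : Pred (Pos × Tile) ℓ} (P? : Decidable P) →
  (∀ {t} → P (p , t)) → ∀ α → lookup (filter P? α) p ≡ lookup α p
lookup-filter P? Pp [] = refl
lookup-filter {p = p} P? Pp ((q , t) ∷ α) with P? (q , t)
... | yes _ with q ≟p p
...   | yes _ = refl
...   | no _ = lookup-filter P? Pp α
lookup-filter {p = p} P? Pp ((q , t) ∷ α) | no ¬P with q ≟p p
...   | yes refl = ⊥-elim (¬P Pp)
...   | no _ = lookup-filter P? Pp α

lookup-∪ : ∀ α β p → lookup (α ∪ β) p ≡ lookup α p <∣> lookup β p
lookup-∪ α β p with lookup α p in eq | lookup-++ α (filter (λ e → ¬? (proj₁ e ∈? dom α)) β) p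
... | just _ | e = e
... | nothing | e = trans e (lookup-filter _ p∉α β)
  where
  p∉α : p ∉ dom α
  p∉α p∈α with ∈dom⇒lookup-just α p∈α
  ... | _ , eq′ with trans (sym eq) eq′
  ... | ()

<∣>-just : ∀ {x : A} (m n : Maybe A) → m <∣> n ≡ just x → m ≡ just x ⊎ n ≡ just x
<∣>-just (just _) n eq = inj₁ eq
<∣>-just nothing n eq = inj₂ eq

<∣>-comm-apart : ∀ (m n : Maybe A) → (∀ {x y} → m ≡ just x → n ≡ just y → ⊥) →
  m <∣> n ≡ n <∣> m
<∣>-comm-apart (just _) (just _) apart = ⊥-elim (apart refl refl)
<∣>-comm-apart (just _) nothing apart = refl
<∣>-comm-apart nothing (just _) apart = refl
<∣>-comm-apart nothing nothing apart = refl

dom-filter : ∀ {P : Pred Pos ℓ} (P? : Decidable P) α →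
  dom (filter (λ e → P? (proj₁ e)) α) ≡ filter P? (dom α)
dom-filter P? [] = refl
dom-filter P? (e ∷ α) with does (P? (proj₁ e))
... | true = cong (proj₁ e ∷_) (dom-filter P? α)
... | false = dom-filter P? α

dom-∪ : ∀ α β → dom (α ∪ β) ≡ dom α ++ filter (λ p → ¬? (p ∈? dom α)) (dom β)
dom-∪ α β = trans (map-++ proj₁ α _) (cong (dom α ++_) (dom-filter _ β))

dom-∪⁻ : ∀ α β → p ∈ dom (α ∪ β) → p ∈ dom α ⊎ p ∈ dom β
dom-∪⁻ α β p∈ =
  Sum.map₂ (proj₁ ∘ ∈-filter⁻ _ {xs = dom β}) (∈-++⁻ (dom α) (subst (_ ∈_) (dom-∪ α β) p∈))

dom-∪⁺ˡ : ∀ β → p ∈ dom α → p ∈ dom (α ∪ β)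
dom-∪⁺ˡ {α = α} β p∈α = subst (_ ∈_) (sym (dom-∪ α β)) (∈-++⁺ˡ p∈α)

dom-∪⁺ʳ : ∀ α → p ∈ dom β → p ∈ dom (α ∪ β)
dom-∪⁺ʳ {p} {β} α p∈β with p ∈? dom α
... | yes p∈α = dom-∪⁺ˡ β p∈α
... | no p∉α = subst (_ ∈_) (sym (dom-∪ α β)) (∈-++⁺ʳ (dom α) (∈-filter⁺ _ p∈β p∉α))

≐-dom : ∀ α β → α ≐ β → p ∈ dom α → p ∈ dom β
≐-dom {p} α β α≐β p∈α =
  lookup-just⇒∈dom β (trans (sym (α≐β p)) (proj₂ (∈dom⇒lookup-just α p∈α)))

∪-absorbs : ∀ α β → (∀ {p} → p ∈ dom β → p ∈ dom α) → α ∪ β ≡ α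
∪-absorbs α β dom⊆ = begin
  α ++ filter (λ e → ¬? (proj₁ e ∈? dom α)) β  ≡⟨ cong (α ++_) (filter-none _ β-within-α) ⟩
  α ++ []                                      ≡⟨ ++-identityʳ α ⟩
  α                                            ∎
  where
  open ≡-Reasoning
  β-within-α : All.All (λ e → ¬ ¬ proj₁ e ∈ dom α) β
  β-within-α = All.tabulate λ e∈β ¬∈ → ¬∈ (dom⊆ (∈-map⁺ proj₁ e∈β))

∪-unique : ∀ α β → Unique (dom α) → Unique (dom β) → Unique (dom (α ∪ β))
∪-unique α β uα uβ = subst Unique (sym (dom-∪ α β))
  (Unique.++⁺ uα (Unique.filter⁺ _ uβ) λ (p∈α , p∈f) → proj₂ (∈-filter⁻ _ {xs = dom β} p∈f) p∈α)

infix 4 _⊑_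
_⊑_ : Assembly → Assembly → Set
α ⊑ β = ∀ {p t} → lookup α p ≡ just t → lookup β p ≡ just t

⊑-∪ˡ : ∀ α β → α ⊑ α ∪ β
⊑-∪ˡ α β {p} eq = trans (lookup-∪ α β p) (cong (_<∣> lookup β p) eq)

⊑-∪ʳ : ∀ α β → Consistent α β → β ⊑ α ∪ β
⊑-∪ʳ α β α~β {p} {u} eq with lookup α p in eqα | lookup-∪ α β p
... | just t | e = trans e (cong just (α~β p t u eqα eq))
... | nothing | e = trans e eq

⊑⇒⊆ : ∀ α β → Unique (dom α) → α ⊑ β → α ⊆ β
⊑⇒⊆ α β uα α⊑β {p , t} p,t∈ = lookup-just⇒∈ β (α⊑β (∈⇒lookup-just α uα p,t∈))

Consistent-∪ˡ : ∀ α β γ → Consistent α γ → Consistent β γ → Consistent (α ∪ β) γ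
Consistent-∪ˡ α β γ α~γ β~γ p t u eq eqγ
  with <∣>-just (lookup α p) (lookup β p) (trans (sym (lookup-∪ α β p)) eq)
... | inj₁ eqα = α~γ p t u eqα eqγ
... | inj₂ eqβ = β~γ p t u eqβ eqγ

DisjointDom⇒Consistent : ∀ α β → DisjointDom α β → Consistent α β
DisjointDom⇒Consistent α β dj p t u eqα eqβ =
  ⊥-elim (dj p (lookup-just⇒∈dom α eqα) (lookup-just⇒∈dom β eqβ))

Consistent-≐ʳ : ∀ α β γ → β ≐ γ → Consistent α β → Consistent α γ
Consistent-≐ʳ α β γ β≐γ α~β p t u eqα eqγ = α~β p t u eqα (trans (β≐γ p) eqγ)

Consistent-∪⁻ˡ : ∀ α β₁ β₂ → Consistent α (β₁ ∪ β₂) → Consistent α β₁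
Consistent-∪⁻ˡ α β₁ β₂ α~β p t u eqα eq₁ = α~β p t u eqα (⊑-∪ˡ β₁ β₂ eq₁)

Consistent-∪⁻ʳ : ∀ α β₁ β₂ → DisjointDom β₁ β₂ → Consistent α (β₁ ∪ β₂) → Consistent α β₂
Consistent-∪⁻ʳ α β₁ β₂ β₁#β₂ α~β p t u eqα eq₂ =
  α~β p t u eqα (⊑-∪ʳ β₁ β₂ (DisjointDom⇒Consistent β₁ β₂ β₁#β₂) eq₂)

DisjointDom-∪ˡ : ∀ α β γ → DisjointDom α γ → DisjointDom β γ → DisjointDom (α ∪ β) γ
DisjointDom-∪ˡ α β γ dα dβ p p∈ = Sum.[ dα p , dβ p ] (dom-∪⁻ α β p∈)

DisjointDom-sym : ∀ α β → DisjointDom α β → DisjointDom β α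
DisjointDom-sym α β α#β p p∈β p∈α = α#β p p∈α p∈β

∪-congʳ : ∀ α β γ → β ≐ γ → (α ∪ β) ≐ (α ∪ γ)
∪-congʳ α β γ β≐γ p = begin
  lookup (α ∪ β) p           ≡⟨ lookup-∪ α β p ⟩
  lookup α p <∣> lookup β p  ≡⟨ cong (lookup α p <∣>_) (β≐γ p) ⟩
  lookup α p <∣> lookup γ p  ≡⟨ lookup-∪ α γ p ⟨
  lookup (α ∪ γ) p           ∎
  where open ≡-Reasoning

∪-assoc : ∀ α β γ → (α ∪ (β ∪ γ)) ≐ ((α ∪ β) ∪ γ)
∪-assoc α β γ p = begin
  lookup (α ∪ (β ∪ γ)) p                       ≡⟨ lookup-∪ α (β ∪ γ) p ⟩
  lookup α p <∣> lookup (β ∪ γ) p              ≡⟨ cong (lookup α p <∣>_) (lookup-∪ β γ p) ⟩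
  lookup α p <∣> (lookup β p <∣> lookup γ p)   ≡⟨ <∣>-assoc (lookup α p) _ _ ⟨
  (lookup α p <∣> lookup β p) <∣> lookup γ p   ≡⟨ cong (_<∣> lookup γ p) (lookup-∪ α β p) ⟨
  lookup (α ∪ β) p <∣> lookup γ p              ≡⟨ lookup-∪ (α ∪ β) γ p ⟨
  lookup ((α ∪ β) ∪ γ) p                       ∎
  where open ≡-Reasoning

∪-comm : ∀ α β → DisjointDom α β → (α ∪ β) ≐ (β ∪ α)
∪-comm α β dj p = begin
  lookup (α ∪ β) p           ≡⟨ lookup-∪ α β p ⟩
  lookup α p <∣> lookup β p  ≡⟨ <∣>-comm-apart _ _ apart ⟩
  lookup β p <∣> lookup α p  ≡⟨ lookup-∪ β α p ⟨
  lookup (β ∪ α) p           ∎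
  where
  open ≡-Reasoning
  apart : ∀ {t u} → lookup α p ≡ just t → lookup β p ≡ just u → ⊥
  apart eqα eqβ = dj p (lookup-just⇒∈dom α eqα) (lookup-just⇒∈dom β eqβ)

∪-regroup : ∀ α β β₁ β₂ → β ≐ (β₁ ∪ β₂) → (α ∪ β) ≐ ((α ∪ β₁) ∪ β₂)
∪-regroup α β β₁ β₂ β≐ p = trans (∪-congʳ α β (β₁ ∪ β₂) β≐ p) (∪-assoc α β₁ β₂ p)

sum-concatMap : ∀ (f : A → List ℕ) xs → sum (concatMap f xs) ≡ sum (map (sum ∘ f) xs)
sum-concatMap f [] = refl
sum-concatMap f (x ∷ xs) =
  trans (sum-++ (f x) (concatMap f xs)) (cong (sum (f x) +_) (sum-concatMap f xs))

sum-map-mono : ∀ {f g : A → ℕ} → (∀ x → f x ≤ g x) → ∀ xs → sum (map f xs) ≤ sum (map g xs)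
sum-map-mono f≤g [] = z≤n
sum-map-mono f≤g (x ∷ xs) = +-mono-≤ (f≤g x) (sum-map-mono f≤g xs)

sum-map-mono-⊆ : ∀ (f : A → ℕ) → Unique xs → xs ⊆ ys → sum (map f xs) ≤ sum (map f ys)
sum-map-mono-⊆ f [] _ = z≤n
sum-map-mono-⊆ {xs = x ∷ xs} f (x∉xs ∷ uxs) xs⊆ys with ∈-∃++ (xs⊆ys (here refl))
... | as , bs , refl = begin
  f x + sum (map f xs)              ≤⟨ +-monoʳ-≤ (f x) (sum-map-mono-⊆ f uxs xs⊆as++bs) ⟩
  f x + sum (map f (as ++ bs))      ≡⟨ sum-↭ (map⁺ f (shift x as bs)) ⟨
  sum (map f (as ++ [ x ] ++ bs))   ∎
  where
  open ≤-Reasoning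
  xs⊆as++bs : xs ⊆ as ++ bs
  xs⊆as++bs y∈xs with ∈-++⁻ as (xs⊆ys (there y∈xs))
  ... | inj₁ y∈as = ∈-++⁺ˡ y∈as
  ... | inj₂ (here refl) = ⊥-elim (All.lookup x∉xs y∈xs refl)
  ... | inj₂ (there y∈bs) = ∈-++⁺ʳ as y∈bs

doubleSum : (A → A → ℕ) → List A → ℕ
doubleSum w xs = sum (concatMap (λ x → map (w x) xs) xs)

doubleSum-mono-⊆ : ∀ (w : A → A → ℕ) → Unique xs → xs ⊆ ys → doubleSum w xs ≤ doubleSum w ys
doubleSum-mono-⊆ {xs = xs} {ys} w uxs xs⊆ys = begin
  doubleSum w xs                            ≡⟨ sum-concatMap _ xs ⟩
  sum (map (λ x → sum (map (w x) xs)) xs)   ≤⟨ sum-map-mono (λ x → sum-map-mono-⊆ (w x) uxs xs⊆ys) xs ⟩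
  sum (map (λ x → sum (map (w x) ys)) xs)   ≤⟨ sum-map-mono-⊆ (λ x → sum (map (w x) ys)) uxs xs⊆ys ⟩
  sum (map (λ y → sum (map (w y) ys)) ys)   ≡⟨ sum-concatMap _ ys ⟨
  doubleSum w ys                            ∎
  where open ≤-Reasoning

crossing : (Pos → Bool) → Pos × Tile → Pos × Tile → ℕ
crossing c e e′ = if c (proj₁ e) then (if c (proj₁ e′) then 0 else bond e e′) else 0

-- cutWeight α c unfolds to doubleSum (crossing c) α.
cutWeight-mono : ∀ c → Unique α → α ⊆ β → cutWeight α c ≤ cutWeight β c
cutWeight-mono c = doubleSum-mono-⊆ (crossing c)

Overlap : Assembly → Assembly → Set
Overlap α β = ∃ λ p → p ∈ dom α × p ∈ dom β

overlap-or-disjoint : ∀ α β → Overlap α β ⊎ DisjointDom α β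
overlap-or-disjoint α β with any? (_∈? dom β) (dom α)
... | yes some = inj₁ (find some)
... | no none = inj₂ λ p p∈α p∈β → none (lose p∈α p∈β)

StableAssembly : ℕ → Assembly → Set
StableAssembly τ α = IsAssembly α × Stable τ α

path-mono : (∀ {p} → p ∈ dom α → p ∈ dom β) → Path α p q → Path β p q
path-mono dom⊆ here = here
path-mono dom⊆ (step adj q∈ path) = step adj (dom⊆ q∈) (path-mono dom⊆ path)

path-++ : ∀ {r} → Path α p q → Path α q r → Path α p r
path-++ here path′ = path′
path-++ (step adj q∈ path) path′ = step adj q∈ (path-++ path path′)

∪-isAssembly : ∀ α β → IsAssembly α → IsAssembly β → Overlap α β → IsAssembly (α ∪ β)
∪-isAssembly α β (α≢[] , uα , connα) (_ , uβ , connβ) (o , oα , oβ) =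
  α≢[] ∘ ++-conicalˡ α _ , ∪-unique α β uα uβ , connected
  where
  to-o : p ∈ dom α ⊎ p ∈ dom β → Path (α ∪ β) p o
  to-o (inj₁ p∈α) = path-mono (dom-∪⁺ˡ β) (connα _ o p∈α oα)
  to-o (inj₂ p∈β) = path-mono (dom-∪⁺ʳ α) (connβ _ o p∈β oβ)
  from-o : p ∈ dom α ⊎ p ∈ dom β → Path (α ∪ β) o p
  from-o (inj₁ p∈α) = path-mono (dom-∪⁺ˡ β) (connα o _ oα p∈α)
  from-o (inj₂ p∈β) = path-mono (dom-∪⁺ʳ α) (connβ o _ oβ p∈β)
  connected : GridConnected (α ∪ β)
  connected p q p∈ q∈ = path-++ (to-o (dom-∪⁻ α β p∈)) (from-o (dom-∪⁻ α β q∈))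

restrict-cut : ∀ α β {c} → Overlap α β → NontrivialCut (α ∪ β) c →
  NontrivialCut α c ⊎ NontrivialCut β c
restrict-cut α β {c} (o , oα , oβ) ((p , p∈ , cp) , (q , q∈ , cq)) with c o in co
... | true = Sum.map (λ q∈α → (o , oα , co) , (q , q∈α , cq))
                     (λ q∈β → (o , oβ , co) , (q , q∈β , cq)) (dom-∪⁻ α β q∈)
... | false = Sum.map (λ p∈α → (p , p∈α , cp) , (o , oα , co))
                      (λ p∈β → (p , p∈β , cp) , (o , oβ , co)) (dom-∪⁻ α β p∈)

∪-stable : ∀ α β {τ} → Unique (dom α) → Unique (dom β) → Consistent α β → Overlap α β →
  Stable τ α → Stable τ β → Stable τ (α ∪ β)
∪-stable α β uα uβ α~β o stα stβ c cut with restrict-cut α β o cut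
... | inj₁ cutα = ≤-trans (stα c cutα) (cutWeight-mono c (Unique.map⁻ uα) ∈-++⁺ˡ)
... | inj₂ cutβ = ≤-trans (stβ c cutβ) (cutWeight-mono c (Unique.map⁻ uβ) β⊆α∪β)
  where
  β⊆α∪β : β ⊆ α ∪ β
  β⊆α∪β = ⊑⇒⊆ β (α ∪ β) uβ (⊑-∪ʳ α β α~β)

∪-stableAssembly : ∀ α β {τ} → StableAssembly τ α → StableAssembly τ β → Consistent α β →
  Overlap α β → StableAssembly τ (α ∪ β)
∪-stableAssembly α β (asmα@(_ , uα , _) , stα) (asmβ@(_ , uβ , _) , stβ) α~β o =
  ∪-isAssembly α β asmα asmβ o , ∪-stable α β uα uβ α~β o stα stβ

singleton-stableAssembly : ∀ {τ} p t → StableAssembly τ [ (p , t) ]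
singleton-stableAssembly {τ} p t = ((λ ()) , All.[] ∷ [] , connected) , stable
  where
  connected : GridConnected [ (p , t) ]
  connected _ _ (here refl) (here refl) = here
  stable : Stable τ [ (p , t) ]
  stable c ((_ , here refl , cp) , (_ , here refl , cp′)) with trans (sym cp) cp′
  ... | ()

∈-≐-singleton : ∀ γ p t → Unique (dom γ) → γ ≐ [ (p , t) ] → (q , u) ∈ γ → (q , u) ≡ (p , t)
∈-≐-singleton {q} γ p t uγ γ≐ q,u∈
  with lookup-just⇒∈ [ (p , t) ] (trans (sym (γ≐ q)) (∈⇒lookup-just γ uγ q,u∈))
... | here eq = eq

≐-singleton : ∀ γ p t → γ ≢ [] → Unique (dom γ) → γ ≐ [ (p , t) ] → γ ≡ [ (p , t) ]
≐-singleton [] p t γ≢[] _ _ = ⊥-elim (γ≢[] refl)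
≐-singleton γ@(_ ∷ []) p t _ uγ γ≐ = cong [_] (∈-≐-singleton γ p t uγ γ≐ (here refl))
≐-singleton γ@((q , u) ∷ (q′ , u′) ∷ _) p t _ uγ@(q∉ ∷ _) γ≐
  with ∈-≐-singleton γ p t uγ γ≐ (here refl) | ∈-≐-singleton γ p t uγ γ≐ (there (here refl))
... | refl | refl = ⊥-elim (All.lookup q∉ (here refl) refl)

module _ {𝒯 : HTAS} where

  producible⇒tree : Producible 𝒯 α → AssemblyTree 𝒯 α
  producible⇒tree (single p t t∈T) = leaf p t t∈T
  producible⇒tree (combine pα pβ c) = node (producible⇒tree pα) (producible⇒tree pβ) c

  tree⇒producible : AssemblyTree 𝒯 α → Producible 𝒯 α
  tree⇒producible (leaf p t t∈T) = single p t t∈T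
  tree⇒producible (node tα tβ c) = combine (tree⇒producible tα) (tree⇒producible tβ) c

  tree-stableAssembly : AssemblyTree 𝒯 α → StableAssembly (τ 𝒯) α
  tree-stableAssembly (leaf p t _) = singleton-stableAssembly p t
  tree-stableAssembly (node _ _ c) = Combines.assembly c , Combines.stable c

  combines : DisjointDom α β → γ ≐ (α ∪ β) → StableAssembly (τ 𝒯) γ → Combines 𝒯 α β γ
  combines dj γ≐ (asm , st) = record { disjoint = dj ; union = γ≐ ; assembly = asm ; stable = st }

  _≼_ : AssemblyTree 𝒯 α → AssemblyTree 𝒯 β → Set
  t ≼ t′ = ∀ {δ} → OccursIn δ t → OccursIn δ t′

  -- Combined assemblies are only determined up to ≐, so a tree is moved along ≐
  -- by relabelling its root; a leaf needs ≐ to be an equality of lists.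
  retarget : (t : AssemblyTree 𝒯 γ) → δ ≐ γ → StableAssembly (τ 𝒯) δ → Σ (AssemblyTree 𝒯 δ) (t ≼_)
  retarget (leaf p t t∈T) δ≐ ((δ≢[] , uδ , _) , _) with ≐-singleton _ p t δ≢[] uδ δ≐
  ... | refl = leaf p t t∈T , λ o → o
  retarget {δ = δ} (node {β₁} {β₂} l r c) δ≐ ok = node l r c′ , embed
    where
    open Combines c
    c′ : Combines 𝒯 β₁ β₂ δ
    c′ = combines disjoint (λ p → trans (δ≐ p) (union p)) ok
    embed : node l r c ≼ node l r c′
    embed (at-root ε≐) = at-root (λ p → trans (ε≐ p) (sym (δ≐ p)))
    embed (in-left o) = in-left o
    embed (in-right o) = in-right o

  ∪-tree : (tα : AssemblyTree 𝒯 α) → AssemblyTree 𝒯 β → Consistent α β → Overlap α β →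
    Σ (AssemblyTree 𝒯 (α ∪ β)) (tα ≼_)
  ∪-tree {α} tα (leaf q u _) _ (_ , q∈α , here refl)
    rewrite ∪-absorbs α [ (q , u) ] (λ { (here refl) → q∈α }) = tα , λ o → o
  ∪-tree {α} {β} tα (node {β₁} {β₂} l r c) α~β (p , p∈α , p∈β) =
    go (overlap-or-disjoint α β₁) (overlap-or-disjoint α β₂)
    where
    open Combines c
    ok : StableAssembly (τ 𝒯) (α ∪ β)
    ok = ∪-stableAssembly α β (tree-stableAssembly tα) (tree-stableAssembly (node l r c))
           α~β (p , p∈α , p∈β)
    α~β₁∪β₂ : Consistent α (β₁ ∪ β₂)
    α~β₁∪β₂ = Consistent-≐ʳ α β (β₁ ∪ β₂) union α~β
    α~β₁ : Consistent α β₁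
    α~β₁ = Consistent-∪⁻ˡ α β₁ β₂ α~β₁∪β₂
    α~β₂ : Consistent α β₂
    α~β₂ = Consistent-∪⁻ʳ α β₁ β₂ disjoint α~β₁∪β₂
    regroup₁₂ : (α ∪ β) ≐ ((α ∪ β₁) ∪ β₂)
    regroup₁₂ = ∪-regroup α β β₁ β₂ union
    regroup₂₁ : (α ∪ β) ≐ ((α ∪ β₂) ∪ β₁)
    regroup₂₁ = ∪-regroup α β β₂ β₁ (λ q → trans (union q) (∪-comm β₁ β₂ disjoint q))
    go : Overlap α β₁ ⊎ DisjointDom α β₁ → Overlap α β₂ ⊎ DisjointDom α β₂ →
      Σ (AssemblyTree 𝒯 (α ∪ β)) (tα ≼_)
    go (inj₁ o₁) (inj₁ (x , x∈α , x∈β₂)) =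
      let α∪β₁~β₂ = Consistent-∪ˡ α β₁ β₂ α~β₂ (DisjointDom⇒Consistent β₁ β₂ disjoint)
          t₁ , tα≼t₁ = ∪-tree tα l α~β₁ o₁
          t₂ , t₁≼t₂ = ∪-tree t₁ r α∪β₁~β₂ (x , dom-∪⁺ˡ β₁ x∈α , x∈β₂)
          t , t₂≼t = retarget t₂ regroup₁₂ ok
      in t , t₂≼t ∘ t₁≼t₂ ∘ tα≼t₁
    go (inj₁ o₁) (inj₂ α#β₂) =
      let t₁ , tα≼t₁ = ∪-tree tα l α~β₁ o₁
          α∪β₁#β₂ = DisjointDom-∪ˡ α β₁ β₂ α#β₂ disjoint
      in node t₁ r (combines α∪β₁#β₂ regroup₁₂ ok) , in-left ∘ tα≼t₁
    go (inj₂ α#β₁) (inj₁ o₂) =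
      let t₂ , tα≼t₂ = ∪-tree tα r α~β₂ o₂
          α∪β₂#β₁ = DisjointDom-∪ˡ α β₂ β₁ α#β₁ (DisjointDom-sym β₁ β₂ disjoint)
      in node t₂ l (combines α∪β₂#β₁ regroup₂₁ ok) , in-left ∘ tα≼t₂
    go (inj₂ α#β₁) (inj₂ α#β₂) =
      ⊥-elim (Sum.[ α#β₁ p p∈α , α#β₂ p p∈α ] (dom-∪⁻ β₁ β₂ (≐-dom β (β₁ ∪ β₂) union p∈β)))

theorem5p1 : (𝒯 : HTAS) (α β : Assembly) →
    Producible 𝒯 α → Producible 𝒯 β → Consistent α β →
    (∃ λ p → p ∈ dom α × p ∈ dom β) →
    Producible 𝒯 (α ∪ β) × (α ⟶⟨ 𝒯 ⟩ (α ∪ β))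
theorem5p1 𝒯 α β pα pβ α~β common =
  let t , tα≼t = ∪-tree (producible⇒tree pα) (producible⇒tree pβ) α~β common
  in tree⇒producible t , t , tα≼t (at-root (λ _ → refl))
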